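{- Let $q=2^e$. Let $L_m(q)$ be the bipartite graph whose vertex set is the disjoint union of a point set $\mathbb{F}_q^{m+1}$ and a line set $\mathbb{F}_q^{m+1}$, with a point $P=(p_1,\dots,p_{m+1})$ adjacent to a line $L=[l_1,\dots,l_{m+1}]$ if and only if $l_k+p_k=p_1^{\,2^{k-2}}\,l_1$ for all $k=2,\dots,m+1$. Suppose either $e=m=1$, or $e\ge1$ and $m\ge2$. Then the girth of $L_m(q)$ is $8$.
   Context: The girth is the length of a shortest cycle in the graph. -}

module Defs where

open import Data.Nat using (ℕ; zero; suc; _≤_; _≥_)
import Data.Nat as ℕ
open import Data.Fin using (Fin; zero; suc; inject₁; fromℕ)
open import Data.Vec using (Vec; lookup)
open import Data.Sum using (_⊎_; inj₁; inj₂)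
open import Data.Product using (Σ; _×_; ∃-syntax)
open import Data.Empty using (⊥)
open import Relation.Nullary using (¬_)
open import Relation.Binary.PropositionalEquality using (_≡_)
open import Algebra.Structures using (IsCommutativeRing)
open import Function.Definitions using (Injective)
open import Function.Bundles using (_↔_)

record Field : Set₁ where
  field
    Carrier : Set
    _+_ _*_ : Carrier → Carrier → Carrier
    -_ : Carrier → Carrier
    0# 1# : Carrier
    isCommutativeRing : IsCommutativeRing _≡_ _+_ _*_ -_ 0# 1#
    0≢1 : ¬ (0# ≡ 1#)
    inverse : ∀ x → ¬ (x ≡ 0#) → Σ Carrier (λ y → (x * y) ≡ 1#)

  _^_ : Carrier → ℕ → Carrier
  x ^ zero = 1#
  x ^ suc n = x * (x ^ n)

record FiniteField (q : ℕ) : Set₁ where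
  field
    field' : Field
  open Field field' public
  field
    card : Carrier ↔ Fin q

record Cycle {V : Set} (Adj : V → V → Set) (n : ℕ) : Set where
  field
    k : ℕ
    len : n ≡ suc k
    long : 3 ≤ n
    vert : Fin (suc k) → V
    distinct : Injective _≡_ _≡_ vert
    step : (i : Fin k) → Adj (vert (inject₁ i)) (vert (suc i))
    close : Adj (vert (fromℕ k)) (vert zero)

Girth : {V : Set} → (V → V → Set) → ℕ → Set
Girth Adj g = Cycle Adj g × (∀ n → Cycle Adj n → g ≤ n)

-- The graph L_m(q) over a field F, coordinates indexed 0..m
-- (paper's indices 1..m+1).  Point P adjacent to line L iff
-- l_k + p_k = p_1^(2^(k-2)) l_1 for k = 2..m+1.
module _ (F : Field) (m : ℕ) where
  open Field F

  Incident : Vec Carrier (suc m) → Vec Carrier (suc m) → Set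
  Incident p l = (k : Fin m) →
    (lookup l (suc k) + lookup p (suc k))
      ≡ ((lookup p zero ^ (2 ℕ.^ Data.Fin.toℕ k)) * lookup l zero)

  -- vertices: inj₁ = points, inj₂ = lines
  Vertex : Set
  Vertex = Vec Carrier (suc m) ⊎ Vec Carrier (suc m)

  LAdj : Vertex → Vertex → Set
  LAdj (inj₁ p) (inj₂ l) = Incident p l
  LAdj (inj₂ l) (inj₁ p) = Incident p l
  LAdj (inj₁ _) (inj₁ _) = ⊥
  LAdj (inj₂ _) (inj₂ _) = ⊥

-- L_m(q) is the incidence graph of a point–line geometry, hence bipartite, and its girth is at
-- least 8 once two points lie on at most one common line (no 4-cycles) and there is no triangle
-- (no 6-cycles).  A point and the first coordinate of a line through it determine the line, and
-- dually.  Around a 4-cycle the equations l₂ + p₂ = p₁ l₁ combine to (a − a′)(x − x′) = 0 for the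
-- first coordinates a, a′ of the points and x, x′ of the lines, so the two lines coincide.  Around
-- a triangle the equations with p₁ and p₁² form a Vandermonde system with determinant
-- (b − c)(c − a)(y − z), which must vanish; for m = 1 only the first equation exists, and instead
-- the three distinct first coordinates of the points cannot fit into a field with two elements.
-- An explicit 8-cycle with coordinates in {0, 1, −1} attains the bound.

module Submission where

open import Defs
open import Level using (0ℓ)
open import Algebra.Bundles using (CommutativeRing)
import Algebra.Properties.Group as GroupProperties
import Algebra.Solver.Ring.NaturalCoefficients.Default as NaturalCoefficientSolver
open import Data.Bool using (Bool; true; false)
import Data.Bool.Properties as Bool
open import Data.Empty using (⊥; ⊥-elim)
open import Data.Fin as Fin using (Fin; zero; suc; inject₁; fromℕ; toℕ; #_)
open import Data.Nat as ℕ using (ℕ; zero; suc; _≤_; z≤n; s≤s; NonZero; parity)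
open import Data.Nat.Properties using (m≤m+n; m^n≢0)
open import Data.Parity.Base as ℙ using (Parity; 0ℙ; 1ℙ; _⁻¹)
open import Data.Parity.Properties using (⁻¹-involutive; +-cancelʳ-≡)
open import Data.Product using (_×_; _,_)
open import Data.Product.Properties using (≡-dec; ×-≡,≡→≡)
open import Data.Sum using (_⊎_; inj₁; inj₂)
open import Data.Sum.Properties using (inj₁-injective; inj₂-injective)
open import Data.Vec using (Vec; []; _∷_; lookup; replicate)
open import Data.Vec.Properties using (tabulate∘lookup; tabulate-cong; ∷-injective; ∷-injectiveˡ; lookup-replicate)
open import Data.Vec.Relation.Unary.AllPairs using (allPairs?)
open import Data.Vec.Relation.Unary.Unique.Propositional using (Unique)
open import Data.Vec.Relation.Unary.Unique.Propositional.Properties using (lookup-injective)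
open import Function.Base using (_∘_)
open import Function.Bundles using (_↔_; Injection; Inverse)
open import Function.Definitions using (Injective)
open import Function.Properties.Inverse using (↔⇒↣)
open import Relation.Nullary using (¬_; contradiction)
open import Relation.Nullary.Decidable using (False; toWitnessFalse; ¬?; toWitness)
open import Relation.Binary.PropositionalEquality using (_≡_; _≢_; refl; sym; trans; cong; cong₂; module ≡-Reasoning)

module _ {V : Set} {Adj : V → V → Set} (colour : V → Parity)
         (colour-flips : ∀ {u v} → Adj u v → colour v ≡ colour u ⁻¹) where

  private
    ⁻¹-parity-suc : ∀ k s → (parity k ℙ.+ s) ⁻¹ ≡ parity (suc k) ℙ.+ s
    ⁻¹-parity-suc 0 s = refl
    ⁻¹-parity-suc 1 s = ⁻¹-involutive s
    ⁻¹-parity-suc (suc (suc k)) s = ⁻¹-parity-suc k s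

    walk-colour : ∀ k (vert : Fin (suc k) → V) → (∀ i → Adj (vert (inject₁ i)) (vert (suc i))) →
                  colour (vert (fromℕ k)) ≡ parity k ℙ.+ colour (vert zero)
    walk-colour zero    vert step = refl
    walk-colour (suc k) vert step = trans (colour-flips (step (fromℕ k)))
      (trans (cong _⁻¹ (walk-colour k (vert ∘ inject₁) (step ∘ inject₁))) (⁻¹-parity-suc k _))

  cycle-length-even : ∀ {n} → Cycle Adj n → parity n ≡ 0ℙ
  cycle-length-even record { k = k ; len = refl ; vert = vert ; step = step ; close = close } =
    sym (+-cancelʳ-≡ (colour (vert zero)) 0ℙ (parity (suc k))
      (trans (colour-flips close) (trans (cong _⁻¹ (walk-colour k vert step)) (⁻¹-parity-suc k _))))

Cycle-map : ∀ {V : Set} {A B : V → V → Set} → (∀ {u v} → A u v → B u v) → ∀ {n} → Cycle A n → Cycle B n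
Cycle-map A⇒B c = record
  { k = k ; len = len ; long = long ; vert = vert ; distinct = distinct
  ; step = A⇒B ∘ step ; close = A⇒B close }
  where open Cycle c

module IncidenceGeometry {P L : Set} (I : P → L → Set) where

  Levi : P ⊎ L → P ⊎ L → Set
  Levi (inj₁ p) (inj₂ l) = I p l
  Levi (inj₂ l) (inj₁ p) = I p l
  Levi (inj₁ _) (inj₁ _) = ⊥
  Levi (inj₂ _) (inj₂ _) = ⊥

  PartialLinear : Set
  PartialLinear = ∀ {p p′ l l′} → I p l → I p′ l → I p l′ → I p′ l′ → p ≢ p′ → l ≡ l′

  record Triangle : Set where
    field
      p₁ p₂ p₃ : P
      l₁ l₂ l₃ : L
      p₁∈l₁ : I p₁ l₁
      p₂∈l₁ : I p₂ l₁
      p₂∈l₂ : I p₂ l₂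
      p₃∈l₂ : I p₃ l₂
      p₃∈l₃ : I p₃ l₃
      p₁∈l₃ : I p₁ l₃
      p₁≢p₂ : p₁ ≢ p₂
      p₂≢p₃ : p₂ ≢ p₃
      p₃≢p₁ : p₃ ≢ p₁
      l₁≢l₂ : l₁ ≢ l₂
      l₂≢l₃ : l₂ ≢ l₃
      l₃≢l₁ : l₃ ≢ l₁

  private
    side : P ⊎ L → Parity
    side (inj₁ _) = 0ℙ
    side (inj₂ _) = 1ℙ

    side-flips : ∀ {u v} → Levi u v → side v ≡ side u ⁻¹
    side-flips {inj₁ _} {inj₂ _} _ = refl
    side-flips {inj₂ _} {inj₁ _} _ = refl

  no-quadrilateral : PartialLinear → ∀ {u₀ u₁ u₂ u₃} →
    Levi u₀ u₁ → Levi u₁ u₂ → Levi u₂ u₃ → Levi u₃ u₀ → u₀ ≢ u₂ → u₁ ≢ u₃ → ⊥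
  no-quadrilateral pl {inj₁ _} {inj₂ _} {inj₁ _} {inj₂ _} a b c d p≢p′ l≢l′ =
    l≢l′ (cong inj₂ (pl a b d c (p≢p′ ∘ cong inj₁)))
  no-quadrilateral pl {inj₂ _} {inj₁ _} {inj₂ _} {inj₁ _} a b c d l≢l′ p≢p′ =
    l≢l′ (cong inj₂ (pl a d b c (p≢p′ ∘ cong inj₁)))
  no-quadrilateral _ {inj₁ _} {inj₁ _} ()
  no-quadrilateral _ {inj₂ _} {inj₂ _} ()
  no-quadrilateral _ {inj₁ _} {inj₂ _} {inj₂ _} _ ()
  no-quadrilateral _ {inj₂ _} {inj₁ _} {inj₁ _} _ ()
  no-quadrilateral _ {inj₁ _} {inj₂ _} {inj₁ _} {inj₁ _} _ _ ()
  no-quadrilateral _ {inj₂ _} {inj₁ _} {inj₂ _} {inj₂ _} _ _ ()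

  no-hexagon : ¬ Triangle → ∀ {u₀ u₁ u₂ u₃ u₄ u₅} →
    Levi u₀ u₁ → Levi u₁ u₂ → Levi u₂ u₃ → Levi u₃ u₄ → Levi u₄ u₅ → Levi u₅ u₀ →
    u₀ ≢ u₂ → u₂ ≢ u₄ → u₄ ≢ u₀ → u₁ ≢ u₃ → u₃ ≢ u₅ → u₅ ≢ u₁ → ⊥
  no-hexagon ¬△ {inj₁ _} {inj₂ _} {inj₁ _} {inj₂ _} {inj₁ _} {inj₂ _} a b c d e f n₀₂ n₂₄ n₄₀ n₁₃ n₃₅ n₅₁ =
    ¬△ record
      { p₁∈l₁ = a ; p₂∈l₁ = b ; p₂∈l₂ = c ; p₃∈l₂ = d ; p₃∈l₃ = e ; p₁∈l₃ = f
      ; p₁≢p₂ = n₀₂ ∘ cong inj₁ ; p₂≢p₃ = n₂₄ ∘ cong inj₁ ; p₃≢p₁ = n₄₀ ∘ cong inj₁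
      ; l₁≢l₂ = n₁₃ ∘ cong inj₂ ; l₂≢l₃ = n₃₅ ∘ cong inj₂ ; l₃≢l₁ = n₅₁ ∘ cong inj₂ }
  no-hexagon ¬△ {inj₂ _} {inj₁ _} {inj₂ _} {inj₁ _} {inj₂ _} {inj₁ _} a b c d e f n₀₂ n₂₄ n₄₀ n₁₃ n₃₅ n₅₁ =
    ¬△ record
      { p₁∈l₁ = b ; p₂∈l₁ = c ; p₂∈l₂ = d ; p₃∈l₂ = e ; p₃∈l₃ = f ; p₁∈l₃ = a
      ; p₁≢p₂ = n₁₃ ∘ cong inj₁ ; p₂≢p₃ = n₃₅ ∘ cong inj₁ ; p₃≢p₁ = n₅₁ ∘ cong inj₁
      ; l₁≢l₂ = n₂₄ ∘ cong inj₂ ; l₂≢l₃ = n₄₀ ∘ cong inj₂ ; l₃≢l₁ = n₀₂ ∘ cong inj₂ }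
  no-hexagon _ {inj₁ _} {inj₁ _} ()
  no-hexagon _ {inj₂ _} {inj₂ _} ()
  no-hexagon _ {inj₁ _} {inj₂ _} {inj₂ _} _ ()
  no-hexagon _ {inj₂ _} {inj₁ _} {inj₁ _} _ ()
  no-hexagon _ {inj₁ _} {inj₂ _} {inj₁ _} {inj₁ _} _ _ ()
  no-hexagon _ {inj₂ _} {inj₁ _} {inj₂ _} {inj₂ _} _ _ ()
  no-hexagon _ {inj₁ _} {inj₂ _} {inj₁ _} {inj₂ _} {inj₂ _} _ _ _ ()
  no-hexagon _ {inj₂ _} {inj₁ _} {inj₂ _} {inj₁ _} {inj₁ _} _ _ _ ()
  no-hexagon _ {inj₁ _} {inj₂ _} {inj₁ _} {inj₂ _} {inj₁ _} {inj₁ _} _ _ _ _ ()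
  no-hexagon _ {inj₂ _} {inj₁ _} {inj₂ _} {inj₁ _} {inj₂ _} {inj₂ _} _ _ _ _ ()

  private
    apart : ∀ {n} {vert : Fin n → P ⊎ L} → Injective _≡_ _≡_ vert →
            (i j : Fin n) → {False (i Fin.≟ j)} → vert i ≢ vert j
    apart inj i j {i≢j} = toWitnessFalse i≢j ∘ inj

  girth≥8 : PartialLinear → ¬ Triangle → ∀ {n} → Cycle Levi n → 8 ≤ n
  girth≥8 _ _ record { k = 0 ; len = refl ; long = s≤s () }
  girth≥8 _ _ record { k = 1 ; len = refl ; long = s≤s (s≤s ()) }
  girth≥8 _ _ c@record { k = 2 ; len = refl } = contradiction (cycle-length-even side side-flips c) λ ()
  girth≥8 pl _ record { k = 3 ; len = refl ; distinct = inj ; step = s ; close = cl } =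
    ⊥-elim (no-quadrilateral pl (s (# 0)) (s (# 1)) (s (# 2)) cl (apart inj (# 0) (# 2)) (apart inj (# 1) (# 3)))
  girth≥8 _ _ c@record { k = 4 ; len = refl } = contradiction (cycle-length-even side side-flips c) λ ()
  girth≥8 _ ¬△ record { k = 5 ; len = refl ; distinct = inj ; step = s ; close = cl } =
    ⊥-elim (no-hexagon ¬△ (s (# 0)) (s (# 1)) (s (# 2)) (s (# 3)) (s (# 4)) cl
      (apart inj (# 0) (# 2)) (apart inj (# 2) (# 4)) (apart inj (# 4) (# 0))
      (apart inj (# 1) (# 3)) (apart inj (# 3) (# 5)) (apart inj (# 5) (# 1)))
  girth≥8 _ _ c@record { k = 6 ; len = refl } = contradiction (cycle-length-even side side-flips c) λ ()
  girth≥8 _ _ record { k = suc (suc (suc (suc (suc (suc (suc k)))))) ; len = refl } = m≤m+n 8 k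


module FieldArithmetic (F : Field) where
  open Field F using (Carrier; isCommutativeRing; inverse; _^_)

  commutativeRing : CommutativeRing 0ℓ 0ℓ
  commutativeRing = record { isCommutativeRing = isCommutativeRing }

  open CommutativeRing commutativeRing public
    using (_+_; _*_; -_; 0#; 1#; +-comm; *-identityˡ; *-identityʳ; zeroˡ; -‿inverseʳ; +-group; commutativeSemiring)
  open GroupProperties +-group public
    using (∙-cancelˡ; ∙-cancelʳ; ⁻¹-injective; x∙y⁻¹≈ε⇒x≈y; //-rightDividesˡ)
  open NaturalCoefficientSolver commutativeSemiring using (solve; _:=_; _:+_; _:*_; con)
  open ≡-Reasoning

  0^n≡0 : ∀ n .{{_ : NonZero n}} → 0# ^ n ≡ 0#
  0^n≡0 (suc n) = zeroˡ _

  1^n≡1 : ∀ n → 1# ^ n ≡ 1#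
  1^n≡1 zero    = refl
  1^n≡1 (suc n) = trans (*-identityˡ _) (1^n≡1 n)

  *-cancelˡ-≢0 : ∀ {a x y} → a ≢ 0# → a * x ≡ a * y → x ≡ y
  *-cancelˡ-≢0 {a} {x} {y} a≢0 ax≡ay with inverse a a≢0
  ... | b , ab≡1 = trans (undo x) (trans (cong (b *_) ax≡ay) (sym (undo y)))
    where
    undo : ∀ z → z ≡ b * (a * z)
    undo z = begin
      z             ≡⟨ sym (*-identityˡ z) ⟩
      1# * z        ≡⟨ cong (_* z) (sym ab≡1) ⟩
      (a * b) * z   ≡⟨ solve 3 (λ a b z → (a :* b) :* z := b :* (a :* z)) refl a b z ⟩
      b * (a * z)   ∎

  -- The hypothesis is (a − a′)(x − x′) = 0, written without subtraction.
  cross-cancel : ∀ {a a′ x x′} → a ≢ a′ → a * x + a′ * x′ ≡ a * x′ + a′ * x → x ≡ x′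
  cross-cancel {a} {a′} {x} {x′} a≢a′ eq = *-cancelˡ-≢0 d≢0 (∙-cancelʳ s (d * x) (d * x′) shifted)
    where
    d = a + - a′
    s = a′ * x + a′ * x′

    d≢0 : d ≢ 0#
    d≢0 = a≢a′ ∘ x∙y⁻¹≈ε⇒x≈y a a′

    expand : ∀ u v → (d + a′) * u + a′ * v ≡ d * u + (a′ * u + a′ * v)
    expand = solve 4 (λ d a′ u v → (d :+ a′) :* u :+ a′ :* v := d :* u :+ (a′ :* u :+ a′ :* v)) refl d a′

    shifted : d * x + s ≡ d * x′ + s
    shifted = begin
      d * x + s                   ≡⟨ expand x x′ ⟨
      (d + a′) * x + a′ * x′      ≡⟨ cong (λ c → c * x + a′ * x′) (//-rightDividesˡ a′ a) ⟩
      a * x + a′ * x′             ≡⟨ eq ⟩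
      a * x′ + a′ * x             ≡⟨ cong (λ c → c * x′ + a′ * x) (//-rightDividesˡ a′ a) ⟨
      (d + a′) * x′ + a′ * x      ≡⟨ expand x′ x ⟩
      d * x′ + (a′ * x′ + a′ * x) ≡⟨ cong (d * x′ +_) (+-comm _ _) ⟩
      d * x′ + s                  ∎

  square-balance : ∀ {t t′ r r′ A B C D} →
    t + r ≡ A → t + r′ ≡ B → t′ + r ≡ C → t′ + r′ ≡ D → A + D ≡ C + B
  square-balance {t} {t′} {r} {r′} refl refl refl refl =
    solve 4 (λ t t′ r r′ → (t :+ r) :+ (t′ :+ r′) := (t′ :+ r) :+ (t :+ r′)) refl t t′ r r′

  hexagon-balance : ∀ {t₁ t₂ t₃ r₁ r₂ r₃ A₁ B₁ B₂ C₂ C₃ A₃} →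
    t₁ + r₁ ≡ A₁ → t₁ + r₂ ≡ B₁ → t₂ + r₂ ≡ B₂ → t₂ + r₃ ≡ C₂ → t₃ + r₃ ≡ C₃ → t₃ + r₁ ≡ A₃ →
    A₁ + B₂ + C₃ ≡ B₁ + C₂ + A₃
  hexagon-balance {t₁} {t₂} {t₃} {r₁} {r₂} {r₃} refl refl refl refl refl refl =
    solve 6 (λ t₁ t₂ t₃ r₁ r₂ r₃ →
        (t₁ :+ r₁) :+ (t₂ :+ r₂) :+ (t₃ :+ r₃) := (t₁ :+ r₂) :+ (t₂ :+ r₃) :+ (t₃ :+ r₁))
      refl t₁ t₂ t₃ r₁ r₂ r₃

  -- e₂ − (a + b) e₁ reads (b − c)(c − a)(y − z) = 0, and (b − c)(c − a) ≠ 0 by cross-cancel.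
  hexagon-cancel : ∀ {a b c x y z} → b ≢ c → c ≢ a →
    (a ^ 1) * x + (b ^ 1) * y + (c ^ 1) * z ≡ (b ^ 1) * x + (c ^ 1) * y + (a ^ 1) * z →
    (a ^ 2) * x + (b ^ 2) * y + (c ^ 2) * z ≡ (b ^ 2) * x + (c ^ 2) * y + (a ^ 2) * z →
    y ≡ z
  hexagon-cancel {a} {b} {c} {x} {y} {z} b≢c c≢a e₁ e₂ = cross-cancel u₁≢u₂ (∙-cancelʳ rest _ _ balanced)
    where
    u₁ = b * c + c * a
    u₂ = b * a + c * c
    R₁ = (b ^ 1) * x + (c ^ 1) * y + (a ^ 1) * z
    L₂ = (a ^ 2) * x + (b ^ 2) * y + (c ^ 2) * z
    R₂ = (b ^ 2) * x + (c ^ 2) * y + (a ^ 2) * z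
    rest = R₂ + (a + b) * R₁

    u₁≢u₂ : u₁ ≢ u₂
    u₁≢u₂ = c≢a ∘ cross-cancel b≢c

    expansion : (u₁ * y + u₂ * z) + (R₂ + (a + b) * ((a ^ 1) * x + (b ^ 1) * y + (c ^ 1) * z))
             ≡ (u₁ * z + u₂ * y) + (L₂ + (a + b) * R₁)
    expansion = solve 6 (λ a b c x y z →
      let a¹ = a :* con 1 ; b¹ = b :* con 1 ; c¹ = c :* con 1
          a² = a :* a¹ ; b² = b :* b¹ ; c² = c :* c¹
      in ((b :* c :+ c :* a) :* y :+ (b :* a :+ c :* c) :* z)
           :+ ((b² :* x :+ c² :* y :+ a² :* z) :+ (a :+ b) :* (a¹ :* x :+ b¹ :* y :+ c¹ :* z))
         := ((b :* c :+ c :* a) :* z :+ (b :* a :+ c :* c) :* y)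
           :+ ((a² :* x :+ b² :* y :+ c² :* z) :+ (a :+ b) :* (b¹ :* x :+ c¹ :* y :+ a¹ :* z)))
      refl a b c x y z

    balanced : (u₁ * y + u₂ * z) + rest ≡ (u₁ * z + u₂ * y) + rest
    balanced = begin
      (u₁ * y + u₂ * z) + (R₂ + (a + b) * R₁) ≡⟨ cong (λ w → (u₁ * y + u₂ * z) + (R₂ + (a + b) * w)) e₁ ⟨
      (u₁ * y + u₂ * z) + (R₂ + (a + b) * ((a ^ 1) * x + (b ^ 1) * y + (c ^ 1) * z)) ≡⟨ expansion ⟩
      (u₁ * z + u₂ * y) + (L₂ + (a + b) * R₁) ≡⟨ cong (λ w → (u₁ * z + u₂ * y) + (w + (a + b) * R₁)) e₂ ⟩
      (u₁ * z + u₂ * y) + (R₂ + (a + b) * R₁) ∎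

module Lm (F : Field) where
  open Field F using (Carrier; _^_; 0≢1)
  open FieldArithmetic F
  open IncidenceGeometry using (Levi; PartialLinear; Triangle; girth≥8)

  private
    lookup-≗⇒≡ : ∀ {n} {xs ys : Vec Carrier n} → (∀ i → lookup xs i ≡ lookup ys i) → xs ≡ ys
    lookup-≗⇒≡ {xs = xs} {ys} h = trans (sym (tabulate∘lookup xs)) (trans (tabulate-cong h) (tabulate∘lookup ys))

  module _ {m : ℕ} where

    -- Incident unfolds to a function type, from which Agda cannot infer the point and the line;
    -- the record makes them inferable.
    record _I_ (p l : Vec Carrier (suc m)) : Set where
      constructor incident
      field at : Incident F m p l
    open _I_ public

    incident-line-unique : ∀ {p l l′} → p I l → p I l′ → lookup l zero ≡ lookup l′ zero → l ≡ l′
    incident-line-unique {p} {x ∷ _} {_ ∷ _} p∈l p∈l′ refl =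
      cong (x ∷_) (lookup-≗⇒≡ λ k → ∙-cancelʳ (lookup p (suc k)) _ _ (trans (at p∈l k) (sym (at p∈l′ k))))

    incident-point-unique : ∀ {p p′ l} → p I l → p′ I l → lookup p zero ≡ lookup p′ zero → p ≡ p′
    incident-point-unique {a ∷ _} {_ ∷ _} {l} p∈l p′∈l refl =
      cong (a ∷_) (lookup-≗⇒≡ λ k → ∙-cancelˡ (lookup l (suc k)) _ _ (trans (at p∈l k) (sym (at p′∈l k))))

    triangle-balance : (△ : Triangle _I_) (k : Fin m) →
      let open Triangle △
          e = 2 ℕ.^ toℕ k
      in (lookup p₁ zero ^ e) * lookup l₁ zero + (lookup p₂ zero ^ e) * lookup l₂ zero + (lookup p₃ zero ^ e) * lookup l₃ zero
       ≡ (lookup p₂ zero ^ e) * lookup l₁ zero + (lookup p₃ zero ^ e) * lookup l₂ zero + (lookup p₁ zero ^ e) * lookup l₃ zero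
    triangle-balance △ k =
      hexagon-balance (at p₁∈l₁ k) (at p₂∈l₁ k) (at p₂∈l₂ k) (at p₃∈l₂ k) (at p₃∈l₃ k) (at p₁∈l₃ k)
      where open Triangle △

    triangle-free-of-size-2 : Carrier ↔ Fin 2 → ¬ Triangle _I_
    triangle-free-of-size-2 card △ =
      no-three-distinct (apart p₁∈l₁ p₂∈l₁ p₁≢p₂) (apart p₂∈l₂ p₃∈l₂ p₂≢p₃) (apart p₃∈l₃ p₁∈l₃ p₃≢p₁)
      where
      open Triangle △
      apart : ∀ {p p′ l} → p I l → p′ I l → p ≢ p′ →
              Inverse.to card (lookup p zero) ≢ Inverse.to card (lookup p′ zero)
      apart p∈l p′∈l p≢p′ = p≢p′ ∘ incident-point-unique p∈l p′∈l ∘ Injection.injective (↔⇒↣ card)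
      no-three-distinct : ∀ {u v w : Fin 2} → u ≢ v → v ≢ w → w ≢ u → ⊥
      no-three-distinct {zero}     {zero}               u≢v _   _   = u≢v refl
      no-three-distinct {suc zero} {suc zero}           u≢v _   _   = u≢v refl
      no-three-distinct {zero}     {suc zero} {zero}     _   _   w≢u = w≢u refl
      no-three-distinct {zero}     {suc zero} {suc zero} _   v≢w _   = v≢w refl
      no-three-distinct {suc zero} {zero}     {zero}     _   v≢w _   = v≢w refl
      no-three-distinct {suc zero} {zero}     {suc zero} _   _   w≢u = w≢u refl

  partialLinear : ∀ {m} → PartialLinear (_I_ {suc m})
  partialLinear p∈l p′∈l p∈l′ p′∈l′ p≢p′ =
    incident-line-unique p∈l p∈l′ (cross-cancel (p≢p′ ∘ incident-point-unique p∈l p′∈l)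
      (square-balance (coordinate₁ p∈l) (coordinate₁ p′∈l) (coordinate₁ p∈l′) (coordinate₁ p′∈l′)))
    where
    coordinate₁ : ∀ {p l} → p I l → lookup l (# 1) + lookup p (# 1) ≡ lookup p zero * lookup l zero
    coordinate₁ p∈l = trans (at p∈l zero) (cong (_* _) (*-identityʳ _))

  triangle-free : ∀ {m} → ¬ Triangle (_I_ {suc (suc m)})
  triangle-free △ = l₂≢l₃ (incident-line-unique p₃∈l₂ p₃∈l₃ (hexagon-cancel
      (p₂≢p₃ ∘ incident-point-unique p₂∈l₂ p₃∈l₂)
      (p₃≢p₁ ∘ incident-point-unique p₃∈l₃ p₁∈l₃)
      (triangle-balance △ (# 0))
      (triangle-balance △ (# 1))))
    where open Triangle △

  bit : Bool → Carrier
  bit false = 0#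
  bit true  = 1#

  bit-injective : Injective _≡_ _≡_ bit
  bit-injective {false} {false} _ = refl
  bit-injective {false} {true}  e = ⊥-elim (0≢1 e)
  bit-injective {true}  {false} e = ⊥-elim (0≢1 (sym e))
  bit-injective {true}  {true}  _ = refl

  module _ {m : ℕ} where

    incident-constant : ∀ {a r x t} → (∀ j → t + r ≡ (a ^ (2 ℕ.^ j)) * x) →
                        Incident F m (a ∷ replicate m r) (x ∷ replicate m t)
    incident-constant h k = trans (cong₂ _+_ (lookup-replicate k _) (lookup-replicate k _)) (h (toℕ k))

    point line : Bool → Bool → Vec Carrier (suc m)
    point b c = bit b ∷ replicate m (- bit c)
    line  b c = (bit b + - bit c) ∷ replicate m (bit b)

    point-false-on : ∀ c c′ → Incident F m (point false c) (line c c′)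
    point-false-on c c′ = incident-constant λ j →
      trans (-‿inverseʳ (bit c)) (sym (trans (cong (_* _) (0^n≡0 (2 ℕ.^ j) {{m^n≢0 2 j}})) (zeroˡ _)))

    point-true-on : ∀ b c → Incident F m (point true c) (line b c)
    point-true-on b c = incident-constant λ j → sym (trans (cong (_* _) (1^n≡1 (2 ℕ.^ j))) (*-identityˡ _))

  module _ {m : ℕ} where

    vertex : Bool × Bool × Bool → Vertex F (suc m)
    vertex (true  , b , c) = inj₁ (point b c)
    vertex (false , b , c) = inj₂ (line b c)

    vertex-injective : Injective _≡_ _≡_ vertex
    vertex-injective {true , b , c} {true , b′ , c′} e with ∷-injective (inj₁-injective e)
    ... | head≡ , tail≡ = cong (true ,_) (×-≡,≡→≡
      (bit-injective {b} {b′} head≡ , bit-injective {c} {c′} (⁻¹-injective (∷-injectiveˡ tail≡))))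
    vertex-injective {false , b , c} {false , b′ , c′} e with ∷-injective (inj₂-injective e)
    ... | head≡ , tail≡ with bit-injective {b} {b′} (∷-injectiveˡ tail≡)
    ... | refl = cong (λ c → false , b , c) (bit-injective {c} {c′} (⁻¹-injective (∙-cancelˡ (bit b) _ _ head≡)))
    vertex-injective {true  , _} {false , _} ()
    vertex-injective {false , _} {true  , _} ()

    -- Codes (is-point, b, c) of point b c and line b c, listed around the cycle.
    labels : Vec (Bool × Bool × Bool) 8
    labels = (true , false , false) ∷ (false , false , false) ∷ (true , true , false) ∷ (false , true , false)
           ∷ (true , false , true)  ∷ (false , true , true)   ∷ (true , true , true)  ∷ (false , false , true) ∷ []

    labels-unique : Unique labels
    labels-unique = toWitness {a? = allPairs? (λ u v → ¬? (≡-dec Bool._≟_ (≡-dec Bool._≟_ Bool._≟_) u v)) labels} _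

    octagon : Cycle (LAdj F (suc m)) 8
    octagon = record
      { k        = 7
      ; len      = refl
      ; long     = s≤s (s≤s (s≤s z≤n))
      ; vert     = vertex ∘ lookup labels
      ; distinct = λ e → lookup-injective labels-unique _ _ (vertex-injective e)
      ; step     = λ where
          zero                                   → point-false-on false false
          (suc zero)                             → point-true-on  false false
          (suc (suc zero))                       → point-true-on  true  false
          (suc (suc (suc zero)))                 → point-false-on true  false
          (suc (suc (suc (suc zero))))           → point-false-on true  true
          (suc (suc (suc (suc (suc zero)))))     → point-true-on  true  true
          (suc (suc (suc (suc (suc (suc zero)))))) → point-true-on false true
      ; close    = point-false-on false true
      }

  LAdj⇒Levi : ∀ {m u v} → LAdj F m u v → Levi _I_ u v
  LAdj⇒Levi {u = inj₁ _} {inj₂ _} p∈l = incident p∈l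
  LAdj⇒Levi {u = inj₂ _} {inj₁ _} p∈l = incident p∈l

  girth-8 : ∀ {m} → ¬ Triangle (_I_ {suc m}) → Girth (LAdj F (suc m)) 8
  girth-8 ¬△ = octagon , λ _ c → girth≥8 _I_ partialLinear ¬△ (Cycle-map LAdj⇒Levi c)

open import Data.Nat using (_^_; _≥_)

theorem5p4 : (e m : ℕ) → (F : FiniteField (2 ^ e))
    → ((e ≡ 1 × m ≡ 1) ⊎ (e ≥ 1 × m ≥ 2))
    → Girth (LAdj (FiniteField.field' F) m) 8
theorem5p4 _ _ F (inj₁ (refl , refl)) = girth-8 (triangle-free-of-size-2 card)
  where open FiniteField F using (field'; card)
        open Lm field'
theorem5p4 _ .(suc (suc m)) F (inj₂ (_ , s≤s (s≤s {n = m} z≤n))) = girth-8 triangle-free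
  where open Lm (FiniteField.field' F)
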